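{- Let $G$ and $H$ be two graphs on the same vertex set such that the symmetric difference of $E(G)$ and $E(H)$ has size $k$. Then $|b^A_g(G)-b^A_g(H)|\le k$ and $|b^I_g(G)-b^I_g(H)|\le k$.
   Context: The balance game on a finite simple graph $G$ is played by two players, Admirable (A) and Impish (I), who alternately select a not-yet-labeled vertex of $G$ until all vertices are labeled; Admirable labels each vertex she selects by $0$ and Impish labels each vertex he selects by $1$. Each edge receives the sum modulo $2$ of the labels of its endpoints. Let $e_0$ and $e_1$ be the numbers of edges labeled $0$ and $1$ at the end; the discrepancy is $d=e_1-e_0$. Admirable tries to minimize $d$ and Impish tries to maximize $d$. $b^A_g(G)$ is the value of $d$ under optimal play of both players when Admirable moves first, and $b^I_g(G)$ is the value under optimal play when Impish moves first. -}

module Defs where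

open import Data.Nat using (ℕ; zero; suc; _<ᵇ_)
open import Data.Integer using (ℤ; +_; -_; _+_; _⊓_; _⊔_)
open import Data.Bool using (Bool; true; false; if_then_else_; _xor_; _∧_)
open import Data.Maybe using (Maybe; just; nothing)
open import Data.Fin using (Fin; toℕ; _≟_)
open import Data.List using (List; []; _∷_; map; filter; concatMap; allFin; length; foldr)
open import Data.Product using (_×_; _,_)
open import Relation.Nullary using (¬_; does)
open import Relation.Binary.PropositionalEquality using (_≡_)

record Graph (n : ℕ) : Set where
  field
    adj    : Fin n → Fin n → Bool
    sym    : ∀ i j → adj i j ≡ adj j i
    irrefl : ∀ i → adj i i ≡ false
open Graph public

-- unordered pairs {i,j} of distinct vertices, listed once as (i , j) with i < j
pairs : (n : ℕ) → List (Fin n × Fin n)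
pairs n = concatMap (λ i → map (λ j → (i , j)) (filter (λ j → toℕ i Data.Nat.<? toℕ j) (allFin n))) (allFin n)

edges : ∀ {n} → Graph n → List (Fin n × Fin n)
edges {n} G = filter (λ p → Data.Bool._≟_ (adj G (Data.Product.proj₁ p) (Data.Product.proj₂ p)) true) (pairs n)

symDiffSize : ∀ {n} → Graph n → Graph n → ℕ
symDiffSize {n} G H =
  length (filter (λ p → Data.Bool._≟_ (adj G (Data.Product.proj₁ p) (Data.Product.proj₂ p)
                                        xor adj H (Data.Product.proj₁ p) (Data.Product.proj₂ p)) true) (pairs n))

-- Labels: false = 0 (Admirable), true = 1 (Impish).
-- A (partial) labeling: nothing = not yet labeled.
Labeling : ℕ → Set
Labeling n = Fin n → Maybe Bool

-- label of an edge: sum mod 2 of endpoint labels; contributes +1 if labeled 1, -1 if labeled 0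
edgeContribution : Maybe Bool → Maybe Bool → ℤ
edgeContribution (just a) (just b) = if a xor b then + 1 else - (+ 1)
edgeContribution _ _ = + 0   -- never used on complete labelings

discrepancy : ∀ {n} → Graph n → Labeling n → ℤ
discrepancy G L = foldr _+_ (+ 0) (map (λ p → edgeContribution (L (Data.Product.proj₁ p)) (L (Data.Product.proj₂ p))) (edges G))

data Player : Set where
  Admirable Impish : Player

other : Player → Player
other Admirable = Impish
other Impish    = Admirable

labelOf : Player → Bool
labelOf Admirable = false
labelOf Impish    = true

unlabeled : ∀ {n} → Labeling n → List (Fin n)
unlabeled {n} L = filter (λ v → isNothing? (L v)) (allFin n)
  where
    open import Relation.Nullary using (Dec; yes; no)
    isNothing? : (x : Maybe Bool) → Dec (x ≡ nothing)
    isNothing? nothing  = yes Relation.Binary.PropositionalEquality.refl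
    isNothing? (just _) = no (λ ())

assign : ∀ {n} → Fin n → Bool → Labeling n → Labeling n
assign v b L u = if does (u ≟ v) then just b else L u

best : Player → ℤ → List ℤ → ℤ
best Admirable x xs = foldr _⊓_ x xs
best Impish    x xs = foldr _⊔_ x xs

-- minimax value of the game from labeling L with player p to move;
-- the first argument is a move budget (initially n, the number of vertices,
-- which is exactly the number of moves of the game)
value : ∀ {n} → Graph n → ℕ → Player → Labeling n → ℤ
value G zero    p L = discrepancy G L
value G (suc m) p L with unlabeled L
... | []     = discrepancy G L
... | v ∷ vs = best p (next v) (map next vs)
  where next : _ → ℤ
        next u = value G m (other p) (assign u (labelOf p) L)

emptyLabeling : ∀ {n} → Labeling n
emptyLabeling _ = nothing

bgA : ∀ {n} → Graph n → ℤ
bgA {n} G = value G n Admirable emptyLabeling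

bgI : ∀ {n} → Graph n → ℤ
bgI {n} G = value G n Impish emptyLabeling

{-# OPTIONS --safe #-}
-- Toggling one edge changes the discrepancy of every complete labeling by at
-- most 1, so the final payoffs of the games on G and H differ by at most k.
-- Minimum and maximum are 1-Lipschitz for the sup-distance, so backward
-- induction over the game tree carries this bound up to the minimax values.
module Submission where

open import Defs
open import Data.Nat using (ℕ; _≤_)
open import Data.Integer using (∣_∣; _-_)
open import Data.Product using (_×_)
open import Relation.Binary.PropositionalEquality using (_≡_)

import Data.Nat as ℕ
open import Data.Integer as ℤ using (ℤ; +_; 0ℤ; _+_; _⊓_; _⊔_; +≤+; -≤+)
open import Data.Integer.Properties as ℤ
  using (≤-trans; ≤-reflexive; ≤-total; +-mono-≤; +-monoˡ-≤; ⊓-mono-≤; ⊔-mono-≤;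
         mono-≤-distrib-⊓; mono-≤-distrib-⊔; +-identityˡ; +-identityʳ; drop‿+≤+; ∣-∣-≤; ∣i-j∣≡∣j-i∣)
open import Algebra.Properties.CommutativeSemigroup ℤ.+-commutativeSemigroup using (interchange)
open import Algebra.Properties.AbelianGroup ℤ.+-0-abelianGroup using (xyx⁻¹≈y)
open import Data.Bool using (Bool; true; false; _xor_)
open import Data.Bool.Properties using () renaming (_≟_ to _≟ᵇ_)
open import Data.Maybe using (just; nothing)
open import Data.List using (List; []; _∷_; map; filter; foldr; length)
open import Data.Product using (_,_)
open import Data.Sum using (inj₁; inj₂)
open import Relation.Binary.PropositionalEquality using (refl; subst; subst₂) renaming (sym to ≡-sym)

Within : ℕ → ℤ → ℤ → Set
Within k a b = (a ℤ.≤ b + + k) × (b ℤ.≤ a + + k)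

within-refl : ∀ a → Within 0 a a
within-refl a = ≤-reflexive (≡-sym (+-identityʳ a)) , ≤-reflexive (≡-sym (+-identityʳ a))

module _ {k : ℕ} where

  within-sym : ∀ {a b} → Within k a b → Within k b a
  within-sym (a≤b+k , b≤a+k) = b≤a+k , a≤b+k

  within-+ : ∀ {j a b c d} → Within k a b → Within j c d → Within (k ℕ.+ j) (a + c) (b + d)
  within-+ {j} {a} {b} {c} {d} (a≤b+k , b≤a+k) (c≤d+j , d≤c+j) =
    subst (a + c ℤ.≤_) (interchange b (+ k) d (+ j)) (+-mono-≤ a≤b+k c≤d+j) ,
    subst (b + d ℤ.≤_) (interchange a (+ k) c (+ j)) (+-mono-≤ b≤a+k d≤c+j)

  ⊓-mono-≤-+ : ∀ {a b c d} → a ℤ.≤ b + + k → c ℤ.≤ d + + k → a ⊓ c ℤ.≤ (b ⊓ d) + + k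
  ⊓-mono-≤-+ {b = b} {d = d} a≤b+k c≤d+k =
    ≤-trans (⊓-mono-≤ a≤b+k c≤d+k) (≤-reflexive (≡-sym (mono-≤-distrib-⊓ (+-monoˡ-≤ (+ k)) b d)))

  ⊔-mono-≤-+ : ∀ {a b c d} → a ℤ.≤ b + + k → c ℤ.≤ d + + k → a ⊔ c ℤ.≤ (b ⊔ d) + + k
  ⊔-mono-≤-+ {b = b} {d = d} a≤b+k c≤d+k =
    ≤-trans (⊔-mono-≤ a≤b+k c≤d+k) (≤-reflexive (≡-sym (mono-≤-distrib-⊔ (+-monoˡ-≤ (+ k)) b d)))

  within-⊓ : ∀ {a b c d} → Within k a b → Within k c d → Within k (a ⊓ c) (b ⊓ d)
  within-⊓ {a} {b} {c} {d} (a≤b+k , b≤a+k) (c≤d+k , d≤c+k) =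
    ⊓-mono-≤-+ {b = b} {d = d} a≤b+k c≤d+k , ⊓-mono-≤-+ {b = a} {d = c} b≤a+k d≤c+k

  within-⊔ : ∀ {a b c d} → Within k a b → Within k c d → Within k (a ⊔ c) (b ⊔ d)
  within-⊔ {a} {b} {c} {d} (a≤b+k , b≤a+k) (c≤d+k , d≤c+k) =
    ⊔-mono-≤-+ {b = b} {d = d} a≤b+k c≤d+k , ⊔-mono-≤-+ {b = a} {d = c} b≤a+k d≤c+k

  i≤j≤i+k⇒∣i-j∣≤k : ∀ {a b} → a ℤ.≤ b → b ℤ.≤ a + + k → ∣ a - b ∣ ≤ k
  i≤j≤i+k⇒∣i-j∣≤k {a} {b} a≤b b≤a+k =
    drop‿+≤+ (subst₂ ℤ._≤_ (≡-sym (∣-∣-≤ a≤b)) (xyx⁻¹≈y a (+ k)) (+-monoˡ-≤ (ℤ.- a) b≤a+k))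

  within⇒∣-∣≤ : ∀ {a b} → Within k a b → ∣ a - b ∣ ≤ k
  within⇒∣-∣≤ {a} {b} (a≤b+k , b≤a+k) with ≤-total a b
  ... | inj₁ a≤b = i≤j≤i+k⇒∣i-j∣≤k a≤b b≤a+k
  ... | inj₂ b≤a = subst (_≤ k) (∣i-j∣≡∣j-i∣ b a) (i≤j≤i+k⇒∣i-j∣≤k b≤a a≤b+k)

module _ {A : Set} (c : A → ℤ) (c≈0 : ∀ x → Within 1 (c x) 0ℤ) where

  sumWhere : (A → Bool) → List A → ℤ
  sumWhere g xs = foldr _+_ 0ℤ (map c (filter (λ x → g x ≟ᵇ true) xs))

  disagreements : (A → Bool) → (A → Bool) → List A → ℕ
  disagreements g h xs = length (filter (λ x → (g x xor h x) ≟ᵇ true) xs)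

  sumWhere-within : ∀ g h xs → Within (disagreements g h xs) (sumWhere g xs) (sumWhere h xs)
  sumWhere-within g h [] = within-refl 0ℤ
  sumWhere-within g h (x ∷ xs) with g x | h x
  ... | true  | true  = within-+ (within-refl (c x)) (sumWhere-within g h xs)
  ... | false | false = sumWhere-within g h xs
  ... | true  | false =
    subst (Within _ _) (+-identityˡ (sumWhere h xs)) (within-+ (c≈0 x) (sumWhere-within g h xs))
  ... | false | true  =
    subst (λ s → Within _ s _) (+-identityˡ (sumWhere g xs))
      (within-+ (within-sym (c≈0 x)) (sumWhere-within g h xs))

edgeContribution-within-1 : ∀ a b → Within 1 (edgeContribution a b) 0ℤ
edgeContribution-within-1 (just a) (just b) with a xor b
... | true  = +≤+ (ℕ.s≤s ℕ.z≤n) , +≤+ ℕ.z≤n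
... | false = -≤+ , +≤+ ℕ.z≤n
edgeContribution-within-1 (just _) nothing = +≤+ ℕ.z≤n , +≤+ ℕ.z≤n
edgeContribution-within-1 nothing _        = +≤+ ℕ.z≤n , +≤+ ℕ.z≤n

-- discrepancy and symDiffSize unfold definitionally to sumWhere and disagreements over pairs n.
discrepancy-within : ∀ {n} (G H : Graph n) (L : Labeling n) →
  Within (symDiffSize G H) (discrepancy G L) (discrepancy H L)
discrepancy-within {n} G H L =
  sumWhere-within (λ (u , v) → edgeContribution (L u) (L v))
                  (λ (u , v) → edgeContribution-within-1 (L u) (L v))
                  (λ (u , v) → adj G u v) (λ (u , v) → adj H u v) (pairs n)

best-within : ∀ {k} {B : Set} p (f g : B → ℤ) → (∀ u → Within k (f u) (g u)) →
  ∀ v vs → Within k (best p (f v) (map f vs)) (best p (g v) (map g vs))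
best-within Admirable f g f≈g v []       = f≈g v
best-within Admirable f g f≈g v (u ∷ vs) = within-⊓ (f≈g u) (best-within Admirable f g f≈g v vs)
best-within Impish    f g f≈g v []       = f≈g v
best-within Impish    f g f≈g v (u ∷ vs) = within-⊔ (f≈g u) (best-within Impish f g f≈g v vs)

value-within : ∀ {n} (G H : Graph n) m p L → Within (symDiffSize G H) (value G m p L) (value H m p L)
value-within G H ℕ.zero p L = discrepancy-within G H L
value-within G H (ℕ.suc m) p L with unlabeled L
... | []     = discrepancy-within G H L
... | v ∷ vs = best-within p _ _ (λ u → value-within G H m (other p) (assign u (labelOf p) L)) v vs

proposition2p4 : (n : ℕ) (G H : Graph n) (k : ℕ) → symDiffSize G H ≡ k →
    (∣ bgA G - bgA H ∣ ≤ k) × (∣ bgI G - bgI H ∣ ≤ k)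
proposition2p4 n G H k refl =
  within⇒∣-∣≤ (value-within G H n Admirable emptyLabeling) ,
  within⇒∣-∣≤ (value-within G H n Impish emptyLabeling)
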